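{- Let $\epsilon>0$ be a constant, $s\le n^{1/2-\epsilon}$, $B$ a set with $n/s$ elements, $r=10\log n$ and $\alpha=\sqrt{n}$. Let $R=X\times Y\subseteq B^s\times B^s$ be a rectangle and let $Q=(I,S,\mathcal{A})$ be an $r$-thick square in $R$. If $|S|>(3\alpha)^{|I|}$, then there is a square $Q'=(I',S',\mathcal{A}')$ in $R$ such that \begin{itemize} \item $I'\subseteq I$ and $I'\neq\emptyset$, \item $S'$ has average degree $2\alpha$, \item $|S'|\geq 0.9\cdot (3\alpha)^{|I'|-|I|}\cdot|S|$. \end{itemize}
   Context: A square in $R=X\times Y$ is a triple $(I,S,\mathcal{A})$ with $I\subseteq[s]$, $S\subseteq B^I$, and $\mathcal{A}=\{A_i\subseteq B: i\in[s]\setminus I\}$, such that for every $z\in S$ there exist $x\in X$ and $y\in Y$ with $x|_I=z$, $x_i\in A_i$ for all $i\in[s]\setminus I$, and $y|_I=z$, $y_i\in B\setminus A_i$ for all $i\in[s]\setminus I$. A set $S\subseteq B^I$ is $r$-thick if it is nonempty and for every $i\in I$ and $x\in S$, $|\{x'\in S: \forall j\in I\setminus\{i\},\ x'_j=x_j\}|\ge r$; a square is $r$-thick if $S$ is. For $S\subseteq B^I$ and $i\in I$, $S_{ -i}:=\{x'\in B^{I\setminus\{i\}}: \exists x\in S,\ x|_{I\setminus\{i\}}=x'\}$; $S$ has average degree $\beta$ if $|S|\ge\beta\cdot|S_{ -i}|$ for all $i\in I$. Logarithms are base $2$. -}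

module Defs where

open import Data.Bool using (Bool; true; false; _∧_; if_then_else_)
open import Data.Nat using (ℕ; zero; suc; _+_; _*_; _∸_; _^_; _≤_; _<_)
open import Data.Fin using (Fin)
open import Data.Fin.Subset using (Subset; _∈_; _∉_; ∣_∣)
open import Data.Maybe using (Maybe; just; nothing; is-nothing; is-just)
open import Data.List using (List; []; _∷_; map; concatMap; length; filterᵇ; allFin)
open import Data.Bool.ListAction using (any)
open import Data.Vec using (Vec; []; _∷_; lookup; _[_]≔_)
open import Data.Product using (Σ; _×_; _,_; ∃; ∃-syntax)
open import Relation.Binary.PropositionalEquality using (_≡_)

Pt : ℕ → ℕ → Set
Pt b s = Vec (Fin b) s

-- points of B^I (I ⊆ [s]) encoded as partial vectors: entry just a at i ∈ I, nothing at i ∉ I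
PPt : ℕ → ℕ → Set
PPt b s = Vec (Maybe (Fin b)) s

allVec : ∀ {A : Set} → List A → (s : ℕ) → List (Vec A s)
allVec xs zero = [] ∷ []
allVec xs (suc s) = concatMap (λ x → map (x ∷_) (allVec xs s)) xs

allMaybe : (b : ℕ) → List (Maybe (Fin b))
allMaybe b = nothing ∷ map just (allFin b)

allPPt : (b s : ℕ) → List (PPt b s)
allPPt b s = allVec (allMaybe b) s

count : ∀ {A : Set} → (A → Bool) → List A → ℕ
count P xs = length (filterᵇ P xs)

card : ∀ {b s} → (PPt b s → Bool) → ℕ
card {b} {s} S = count S (allPPt b s)

SubsetOfPow : ∀ {b s} → Subset s → (PPt b s → Bool) → Set
SubsetOfPow {b} {s} I S = ∀ (z : PPt b s) → S z ≡ true →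
  (∀ i → i ∈ I → Σ (Fin b) λ a → lookup z i ≡ just a) × (∀ i → i ∉ I → lookup z i ≡ nothing)

Restricts : ∀ {b s} → Subset s → Pt b s → PPt b s → Set
Restricts I x z = ∀ i → i ∈ I → lookup z i ≡ just (lookup x i)

-- (I, S, 𝒜) is a square in R = X × Y.  The family 𝒜 is given as a total
-- function on [s]; only its values at i ∉ I are used.
IsSquare : ∀ {b s} → (X Y : Pt b s → Bool) → Subset s → (PPt b s → Bool) → (Fin s → Subset b) → Set
IsSquare {b} {s} X Y I S A =
  SubsetOfPow I S ×
  (∀ (z : PPt b s) → S z ≡ true →
     (∃[ x ] (X x ≡ true × Restricts I x z × (∀ i → i ∉ I → lookup x i ∈ A i))) ×
     (∃[ y ] (Y y ≡ true × Restricts I y z × (∀ i → i ∉ I → lookup y i ∉ A i))))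

fiber : ∀ {b s} → (PPt b s → Bool) → PPt b s → Fin s → ℕ
fiber {b} S z i = count (λ a → S (z [ i ]≔ just a)) (allFin b)

-- S is r-thick with r = 10 log₂ n, i.e. every fiber c satisfies c ≥ 10 log₂ n ⇔ n^10 ≤ 2^c
ThickLog : ∀ {b s} → (n : ℕ) → Subset s → (PPt b s → Bool) → Set
ThickLog {b} {s} n I S =
  (∃[ z ] S z ≡ true) ×
  (∀ i → i ∈ I → ∀ (z : PPt b s) → S z ≡ true → n ^ 10 ≤ 2 ^ fiber S z i)

cardProj : ∀ {b s} → (PPt b s → Bool) → Fin s → ℕ
cardProj {b} {s} S i =
  count (λ w → is-nothing (lookup w i) ∧ any (λ a → S (w [ i ]≔ just a)) (allFin b)) (allPPt b s)

-- S has average degree 2√n :  |S| ≥ 2√n |S_{-i}|  ⇔  |S|² ≥ 4n |S_{-i}|²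
AvgDeg2Sqrt : ∀ {b s} → (n : ℕ) → Subset s → (PPt b s → Bool) → Set
AvgDeg2Sqrt n I S = ∀ i → i ∈ I → 4 * n * (cardProj S i * cardProj S i) ≤ card S * card S

{-# OPTIONS --safe #-}
module Submission where

-- Greedily erase coordinates of I at which the current set has average degree below (5/2)√n: each
-- erasure multiplies |S|² by at least 4/(25n), so the lower bound on |S| leaves a nonempty set K of
-- coordinates and a projection P ⊆ B^K of S of average degree at least (5/2)√n along every i ∈ K.
-- Next, choose subsets C j ⊆ B at the erased coordinates j to serve as the new A j.  A point w ∈ P
-- survives if it extends to points of S that lie inside C at every erased coordinate (for the X-witness)
-- and outside C (for the Y-witness).  Exposing the erased coordinates one at a time, an extension is
-- lost at j only if C j puts a whole fibre of S, of size at least 10 log n, on the wrong side, which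
-- happens for at most a 1/n^10 fraction of the choices of C j.  Averaging over all colourings, some C
-- loses at most 2s/n^10 ≤ 1/20 of P, which costs only constant factors in both conclusions.

open import Defs
open import Data.Bool using (Bool; true; false; _∧_; _∨_; not; if_then_else_)
open import Data.Bool.Properties using (∧-inverseʳ; T-≡) renaming (_≟_ to _≟ᵇ_)
open import Data.Bool.ListAction using (any; all)
open import Data.Empty using (⊥; ⊥-elim)
open import Data.Fin as Fin using (Fin; zero; suc; toℕ; fromℕ<)
open import Data.Fin.Properties using (toℕ-injective; toℕ-fromℕ<; toℕ<n; any?)
open import Data.Fin.Subset using (Subset; _⊆_; Nonempty; ∣_∣; _∈_; _∉_)
open import Data.Fin.Subset.Properties using (nonempty?; Empty-unique; ∣⊥∣≡0)
open import Data.List using (List; []; _∷_; map; concatMap; length; allFin; _++_; tabulate; downFrom)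
open import Data.List.Properties using (length-++; length-map; map-tabulate; length-downFrom)
open import Data.List.Relation.Unary.Any using (here; there)
open import Data.List.Membership.Propositional using () renaming (_∈_ to _∈ₗ_)
open import Data.List.Membership.Propositional.Properties using (∈-map⁺; ∈-++⁺ˡ; ∈-++⁺ʳ; ∈-allFin)
open import Data.Maybe using (Maybe; just; nothing; is-nothing)
open import Data.Maybe.Properties using (just-injective) renaming (≡-dec to ≡-decₘ)
open import Data.Nat
open import Data.Nat.Properties
open import Data.Nat.Tactic.RingSolver using (solve-∀)
open import Algebra.Properties.CommutativeSemigroup +-commutativeSemigroup using () renaming (interchange to +-interchange)
open import Algebra.Properties.CommutativeSemigroup *-commutativeSemigroup using (x∙yz≈y∙xz; xy∙z≈xz∙y)
open import Data.Product using (_×_; _,_; ∃-syntax; proj₁; proj₂)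
open import Data.Vec using (Vec; []; _∷_; lookup; _[_]≔_)
open import Data.Vec.Properties using (lookup∘update; lookup∘update′; []=⇒lookup; lookup⇒[]=)
open import Function using (_∘_; id)
open import Function.Bundles using (Equivalence)
open import Relation.Binary.Definitions using (DecidableEquality)
open import Relation.Binary.PropositionalEquality
open import Relation.Nullary using (yes; no; does)
open import Relation.Nullary.Decidable using (dec-true; _×-dec_)

private
  variable
    A B : Set
    s : ℕ

-- Finite sums and counts

𝟙 : Bool → ℕ
𝟙 true = 1
𝟙 false = 0

sumBy : (A → ℕ) → List A → ℕ
sumBy f [] = 0
sumBy f (x ∷ xs) = f x + sumBy f xs

count-∷ : ∀ (P : A → Bool) x xs → count P (x ∷ xs) ≡ 𝟙 (P x) + count P xs
count-∷ P x xs with P x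
... | true = refl
... | false = refl

count≡sumBy : ∀ (P : A → Bool) xs → count P xs ≡ sumBy (𝟙 ∘ P) xs
count≡sumBy P [] = refl
count≡sumBy P (x ∷ xs) = trans (count-∷ P x xs) (cong (𝟙 (P x) +_) (count≡sumBy P xs))

sumBy-++ : ∀ (f : A → ℕ) xs ys → sumBy f (xs ++ ys) ≡ sumBy f xs + sumBy f ys
sumBy-++ f [] ys = refl
sumBy-++ f (x ∷ xs) ys = trans (cong (f x +_) (sumBy-++ f xs ys)) (sym (+-assoc (f x) _ _))

sumBy-cong : ∀ {f g : A → ℕ} xs → (∀ x → f x ≡ g x) → sumBy f xs ≡ sumBy g xs
sumBy-cong [] e = refl
sumBy-cong (x ∷ xs) e = cong₂ _+_ (e x) (sumBy-cong xs e)

sumBy-mono : ∀ {f g : A → ℕ} xs → (∀ x → f x ≤ g x) → sumBy f xs ≤ sumBy g xs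
sumBy-mono [] e = z≤n
sumBy-mono (x ∷ xs) e = +-mono-≤ (e x) (sumBy-mono xs e)

sumBy-+ : ∀ (f g : A → ℕ) xs → sumBy (λ x → f x + g x) xs ≡ sumBy f xs + sumBy g xs
sumBy-+ f g [] = refl
sumBy-+ f g (x ∷ xs) = trans (cong (f x + g x +_) (sumBy-+ f g xs)) (+-interchange (f x) (g x) _ _)

sumBy-*ˡ : ∀ c (f : A → ℕ) xs → sumBy (λ x → c * f x) xs ≡ c * sumBy f xs
sumBy-*ˡ c f [] = sym (*-zeroʳ c)
sumBy-*ˡ c f (x ∷ xs) = trans (cong (c * f x +_) (sumBy-*ˡ c f xs)) (sym (*-distribˡ-+ c (f x) _))

sumBy-const : ∀ c xs → sumBy (λ (_ : A) → c) xs ≡ c * length xs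
sumBy-const c [] = sym (*-zeroʳ c)
sumBy-const c (x ∷ xs) = trans (cong (c +_) (sumBy-const c xs)) (sym (*-suc c (length xs)))

sumBy-map : ∀ (f : B → ℕ) (g : A → B) xs → sumBy f (map g xs) ≡ sumBy (f ∘ g) xs
sumBy-map f g [] = refl
sumBy-map f g (x ∷ xs) = cong (f (g x) +_) (sumBy-map f g xs)

sumBy-concatMap : ∀ (f : B → ℕ) (g : A → List B) xs →
                  sumBy f (concatMap g xs) ≡ sumBy (sumBy f ∘ g) xs
sumBy-concatMap f g [] = refl
sumBy-concatMap f g (x ∷ xs) =
  trans (sumBy-++ f (g x) (concatMap g xs)) (cong (sumBy f (g x) +_) (sumBy-concatMap f g xs))

sumBy-comm : ∀ (f : A → B → ℕ) xs ys →
             sumBy (λ x → sumBy (f x) ys) xs ≡ sumBy (λ y → sumBy (λ x → f x y) xs) ys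
sumBy-comm f [] ys = sym (sumBy-const 0 ys)
sumBy-comm f (x ∷ xs) ys =
  trans (cong (sumBy (f x) ys +_) (sumBy-comm f xs ys)) (sym (sumBy-+ (f x) _ ys))

sumBy≤*length⇒∃≤ : ∀ (f : A → ℕ) M xs → 0 < length xs → sumBy f xs ≤ M * length xs → ∃[ x ] f x ≤ M
sumBy≤*length⇒∃≤ f M (x ∷ xs) _ h with f x ≤? M
... | yes fx≤M = x , fx≤M
... | no fx≰M with xs
...   | [] = x , ≤-trans (m≤m+n (f x) 0) (subst (_ ≤_) (*-identityʳ M) h)
...   | y ∷ ys = sumBy≤*length⇒∃≤ f M (y ∷ ys) z<s (+-cancelˡ-≤ M _ _ (begin
        M + sumBy f (y ∷ ys)      ≤⟨ +-monoˡ-≤ _ (<⇒≤ (≰⇒> fx≰M)) ⟩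
        f x + sumBy f (y ∷ ys)    ≤⟨ h ⟩
        M * suc (length (y ∷ ys)) ≡⟨ *-suc M _ ⟩
        M + M * length (y ∷ ys)   ∎))
  where open ≤-Reasoning

telescope : (e : ℕ → Bool) → e 0 ≡ true → ∀ m →
            𝟙 (not (e m)) ≤ sumBy (λ t → 𝟙 (e t ∧ not (e (suc t)))) (downFrom m)
telescope e e0 zero rewrite e0 = z≤n
telescope e e0 (suc m) with e (suc m)
... | true = z≤n
... | false with e m | telescope e e0 m
...   | true | _ = s≤s z≤n
...   | false | ih = ≤-trans ih (m≤n+m _ _)

sumBy-mono-downFrom : ∀ m {f g : ℕ → ℕ} → (∀ t → t < m → f t ≤ g t) → sumBy f (downFrom m) ≤ sumBy g (downFrom m)
sumBy-mono-downFrom zero h = z≤n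
sumBy-mono-downFrom (suc m) h = +-mono-≤ (h m ≤-refl) (sumBy-mono-downFrom m (λ t t<m → h t (m<n⇒m<1+n t<m)))

∧-true⁻ : ∀ {x y} → x ∧ y ≡ true → x ≡ true × y ≡ true
∧-true⁻ {true} e = refl , e

∨-trueʳ : ∀ x {y} → y ≡ true → x ∨ y ≡ true
∨-trueʳ true _ = refl
∨-trueʳ false e = e

not-true⁻ : ∀ {x} → not x ≡ true → x ≡ false
not-true⁻ {false} _ = refl

nor⇒both : ∀ {x y} → not x ∨ not y ≡ false → x ≡ true × y ≡ true
nor⇒both {true} {true} _ = refl , refl

is-nothing⁻ : ∀ (m : Maybe A) → is-nothing m ≡ true → m ≡ nothing
is-nothing⁻ nothing _ = refl

any-true⁻ : ∀ (P : A → Bool) xs → any P xs ≡ true → ∃[ x ] (x ∈ₗ xs × P x ≡ true)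
any-true⁻ P (x ∷ xs) e with P x in Px
... | true = x , here refl , Px
... | false with any-true⁻ P xs e
...   | y , y∈xs , Py = y , there y∈xs , Py

any-true⁺ : ∀ (P : A → Bool) {x xs} → x ∈ₗ xs → P x ≡ true → any P xs ≡ true
any-true⁺ P (here refl) Px rewrite Px = refl
any-true⁺ P {xs = y ∷ _} (there x∈xs) Px with P y
... | true = refl
... | false = any-true⁺ P x∈xs Px

any-false⁻ : ∀ (P : A → Bool) {x xs} → x ∈ₗ xs → any P xs ≡ false → P x ≡ false
any-false⁻ P {x} x∈xs e with P x in Px
... | false = refl
... | true with () ← trans (sym (any-true⁺ P x∈xs Px)) e

all-true⁺ : ∀ (P : A → Bool) xs → (∀ x → x ∈ₗ xs → P x ≡ true) → all P xs ≡ true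
all-true⁺ P [] h = refl
all-true⁺ P (x ∷ xs) h rewrite h x (here refl) = all-true⁺ P xs (λ y → h y ∘ there)

all-true⁻ : ∀ (P : A → Bool) {x xs} → x ∈ₗ xs → all P xs ≡ true → P x ≡ true
all-true⁻ P (here refl) e = proj₁ (∧-true⁻ e)
all-true⁻ P {xs = y ∷ _} (there x∈xs) e = all-true⁻ P x∈xs (proj₂ (∧-true⁻ {P y} e))

any-cong : ∀ {P Q : A → Bool} xs → (∀ x → P x ≡ Q x) → any P xs ≡ any Q xs
any-cong [] h = refl
any-cong (x ∷ xs) h = cong₂ _∨_ (h x) (any-cong xs h)

all-cong : ∀ {P Q : A → Bool} xs → (∀ x → P x ≡ Q x) → all P xs ≡ all Q xs
all-cong [] h = refl
all-cong (x ∷ xs) h = cong₂ _∧_ (h x) (all-cong xs h)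

count-mono : ∀ (P Q : A → Bool) xs → (∀ x → P x ≡ true → Q x ≡ true) → count P xs ≤ count Q xs
count-mono P Q xs h rewrite count≡sumBy P xs | count≡sumBy Q xs = sumBy-mono xs (𝟙-mono ∘ h)
  where
  𝟙-mono : ∀ {a b} → (a ≡ true → b ≡ true) → 𝟙 a ≤ 𝟙 b
  𝟙-mono {false} _ = z≤n
  𝟙-mono {true} h rewrite h refl = ≤-refl

count-none : ∀ (P : A → Bool) xs → (∀ x → P x ≡ false) → count P xs ≡ 0
count-none P xs h rewrite count≡sumBy P xs = trans (sumBy-cong xs (cong 𝟙 ∘ h)) (sumBy-const 0 xs)

count-split : ∀ (P Q : A → Bool) xs →
              count P xs ≡ count (λ x → P x ∧ Q x) xs + count (λ x → P x ∧ not (Q x)) xs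
count-split P Q xs
  rewrite count≡sumBy P xs | count≡sumBy (λ x → P x ∧ Q x) xs | count≡sumBy (λ x → P x ∧ not (Q x)) xs =
  trans (sumBy-cong xs (λ x → split (P x) (Q x))) (sumBy-+ _ _ xs)
  where
  split : ∀ a b → 𝟙 a ≡ 𝟙 (a ∧ b) + 𝟙 (a ∧ not b)
  split false b = refl
  split true false = refl
  split true true = refl

count-∨ : ∀ (P Q : A → Bool) xs → count (λ x → P x ∨ Q x) xs ≤ count P xs + count Q xs
count-∨ P Q xs rewrite count≡sumBy (λ x → P x ∨ Q x) xs | count≡sumBy P xs | count≡sumBy Q xs =
  ≤-trans (sumBy-mono xs (λ x → 𝟙-∨ (P x) (Q x))) (≤-reflexive (sumBy-+ _ _ xs))
  where
  𝟙-∨ : ∀ a b → 𝟙 (a ∨ b) ≤ 𝟙 a + 𝟙 b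
  𝟙-∨ false b = ≤-refl
  𝟙-∨ true b = s≤s z≤n

count-const∧ : ∀ c (Q : A → Bool) xs → count (λ x → c ∧ Q x) xs ≡ 𝟙 c * count Q xs
count-const∧ true Q xs = sym (+-identityʳ (count Q xs))
count-const∧ false Q xs = count-none (λ _ → false) xs (λ _ → refl)

-- Enumerations of vectors

∈-concatMap : ∀ (g : A → List B) {x y xs} → x ∈ₗ xs → y ∈ₗ g x → y ∈ₗ concatMap g xs
∈-concatMap g (here refl) m = ∈-++⁺ˡ m
∈-concatMap g {xs = x′ ∷ _} (there p) m = ∈-++⁺ʳ (g x′) (∈-concatMap g p m)

∈-allVec : ∀ (xs : List A) s (v : Vec A s) → (∀ i → lookup v i ∈ₗ xs) → v ∈ₗ allVec xs s
∈-allVec xs zero [] h = here refl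
∈-allVec xs (suc s) (x ∷ v) h =
  ∈-concatMap (λ x → map (x ∷_) (allVec xs s)) (h zero) (∈-map⁺ (x ∷_) (∈-allVec xs s v (h ∘ suc)))

∈-allPPt : ∀ b s (z : PPt b s) → z ∈ₗ allPPt b s
∈-allPPt b s z = ∈-allVec (allMaybe b) s z (∈-allMaybe ∘ lookup z)
  where
  ∈-allMaybe : ∀ (m : Maybe (Fin b)) → m ∈ₗ allMaybe b
  ∈-allMaybe nothing = here refl
  ∈-allMaybe (just a) = there (∈-map⁺ just (∈-allFin a))

sumBy-allVec-suc : ∀ (xs : List A) s (f : Vec A (suc s) → ℕ) →
                   sumBy f (allVec xs (suc s)) ≡ sumBy (λ x → sumBy (f ∘ (x ∷_)) (allVec xs s)) xs
sumBy-allVec-suc xs s f =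
  trans (sumBy-concatMap f _ xs) (sumBy-cong xs (λ x → sumBy-map f (x ∷_) (allVec xs s)))

count-allVec-suc : ∀ (P : Vec A (suc s) → Bool) xs →
                   count P (allVec xs (suc s)) ≡ sumBy (λ x → count (P ∘ (x ∷_)) (allVec xs s)) xs
count-allVec-suc {s = s} P xs =
  trans (count≡sumBy P (allVec xs (suc s))) (trans (sumBy-allVec-suc xs s (𝟙 ∘ P))
    (sumBy-cong xs (λ x → sym (count≡sumBy (P ∘ (x ∷_)) (allVec xs s)))))

length-allVec : ∀ (xs : List A) s → length (allVec xs s) ≡ length xs ^ s
length-allVec xs zero = refl
length-allVec xs (suc s) = begin
  length (concatMap (λ x → map (x ∷_) (allVec xs s)) xs) ≡⟨ length-concatMap xs ⟩
  sumBy (λ x → length (map (x ∷_) (allVec xs s))) xs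
    ≡⟨ sumBy-cong xs (λ x → trans (length-map (x ∷_) (allVec xs s)) (length-allVec xs s)) ⟩
  sumBy (λ _ → length xs ^ s) xs                        ≡⟨ sumBy-const _ xs ⟩
  length xs ^ s * length xs                             ≡⟨ *-comm (length xs ^ s) _ ⟩
  length xs ^ suc s                                     ∎
  where
  open ≡-Reasoning
  length-concatMap : ∀ {g : A → List (Vec A (suc s))} ys → length (concatMap g ys) ≡ sumBy (length ∘ g) ys
  length-concatMap [] = refl
  length-concatMap {g = g} (y ∷ ys) = trans (length-++ (g y)) (cong (length (g y) +_) (length-concatMap ys))

-- Each point of P is v [ t ]≔ a for exactly length xs pairs (v , a), one for each value of v at t.
sumBy-count-update : ∀ (xs : List A) s (t : Fin s) (P : Vec A s → Bool) →
  sumBy (λ v → count (λ a → P (v [ t ]≔ a)) xs) (allVec xs s) ≡ length xs * count P (allVec xs s)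
sumBy-count-update xs (suc s) zero P = begin
  sumBy (λ v → count (λ a → P (v [ zero ]≔ a)) xs) (allVec xs (suc s)) ≡⟨ sumBy-allVec-suc xs s _ ⟩
  sumBy (λ _ → sumBy (λ v → count (λ a → P (a ∷ v)) xs) (allVec xs s)) xs ≡⟨ sumBy-const _ xs ⟩
  sumBy (λ v → count (λ a → P (a ∷ v)) xs) (allVec xs s) * length xs ≡⟨ *-comm _ (length xs) ⟩
  length xs * sumBy (λ v → count (λ a → P (a ∷ v)) xs) (allVec xs s) ≡⟨ cong (length xs *_) columns ⟩
  length xs * count P (allVec xs (suc s)) ∎
  where
  open ≡-Reasoning
  columns : sumBy (λ v → count (λ a → P (a ∷ v)) xs) (allVec xs s) ≡ count P (allVec xs (suc s))
  columns = begin
    sumBy (λ v → count (λ a → P (a ∷ v)) xs) (allVec xs s)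
      ≡⟨ sumBy-cong (allVec xs s) (λ v → count≡sumBy (λ a → P (a ∷ v)) xs) ⟩
    sumBy (λ v → sumBy (λ a → 𝟙 (P (a ∷ v))) xs) (allVec xs s)
      ≡⟨ sumBy-comm (λ v a → 𝟙 (P (a ∷ v))) (allVec xs s) xs ⟩
    sumBy (λ a → sumBy (λ v → 𝟙 (P (a ∷ v))) (allVec xs s)) xs
      ≡⟨ sumBy-cong xs (λ a → sym (count≡sumBy (P ∘ (a ∷_)) (allVec xs s))) ⟩
    sumBy (λ a → count (P ∘ (a ∷_)) (allVec xs s)) xs
      ≡⟨ sym (count-allVec-suc P xs) ⟩
    count P (allVec xs (suc s)) ∎
sumBy-count-update xs (suc s) (suc t) P = begin
  sumBy (λ v → count (λ a → P (v [ suc t ]≔ a)) xs) (allVec xs (suc s))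
    ≡⟨ sumBy-allVec-suc xs s _ ⟩
  sumBy (λ x → sumBy (λ v → count (λ a → P (x ∷ (v [ t ]≔ a))) xs) (allVec xs s)) xs
    ≡⟨ sumBy-cong xs (λ x → sumBy-count-update xs s t (P ∘ (x ∷_))) ⟩
  sumBy (λ x → length xs * count (P ∘ (x ∷_)) (allVec xs s)) xs
    ≡⟨ sumBy-*ˡ (length xs) _ xs ⟩
  length xs * sumBy (λ x → count (P ∘ (x ∷_)) (allVec xs s)) xs
    ≡⟨ cong (length xs *_) (sym (count-allVec-suc P xs)) ⟩
  length xs * count P (allVec xs (suc s)) ∎
  where open ≡-Reasoning

card-undefined≤1 : ∀ {b s} (P : PPt b s → Bool) → (∀ w → P w ≡ true → ∀ i → lookup w i ≡ nothing) → card P ≤ 1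
card-undefined≤1 {s = zero} P h with P []
... | true = ≤-refl
... | false = z≤n
card-undefined≤1 {b} {suc s} P h rewrite count-allVec-suc P (allMaybe b) =
  subst (_≤ 1) (sym (trans (cong (card (P ∘ (nothing ∷_)) +_) defined-head-count) (+-identityʳ _)))
    (card-undefined≤1 (P ∘ (nothing ∷_)) (λ w e i → h (nothing ∷ w) e (suc i)))
  where
  defined-head : ∀ a v → P (just a ∷ v) ≡ false
  defined-head a v with P (just a ∷ v) in e
  ... | false = refl
  ... | true with () ← h _ e zero
  defined-head-count : sumBy (λ m → count (P ∘ (m ∷_)) (allPPt b s)) (map just (allFin b)) ≡ 0
  defined-head-count = trans (sumBy-map _ just (allFin b))
    (trans (sumBy-cong (allFin b) (λ a → count-none _ (allPPt b s) (defined-head a))) (sumBy-const 0 (allFin b)))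

count-map : ∀ (P : B → Bool) (f : A → B) xs → count P (map f xs) ≡ count (P ∘ f) xs
count-map P f xs = trans (count≡sumBy P (map f xs)) (trans (sumBy-map _ f xs) (sym (count≡sumBy (P ∘ f) xs)))

count-allFin-suc : ∀ n (P : Fin (suc n) → Bool) →
                   count P (allFin (suc n)) ≡ 𝟙 (P zero) + count (P ∘ suc) (allFin n)
count-allFin-suc n P = begin
  count P (allFin (suc n))                     ≡⟨ count-∷ P zero (tabulate suc) ⟩
  𝟙 (P zero) + count P (tabulate suc)          ≡⟨ cong (λ xs → 𝟙 (P zero) + count P xs) (sym (map-tabulate id suc)) ⟩
  𝟙 (P zero) + count P (map suc (allFin n))    ≡⟨ cong (𝟙 (P zero) +_) (count-map P suc (allFin n)) ⟩
  𝟙 (P zero) + count (P ∘ suc) (allFin n)      ∎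
  where open ≡-Reasoning

-- Colourings and sequential exposure

allSubsets : (b : ℕ) → List (Subset b)
allSubsets b = allVec (true ∷ false ∷ []) b

avoids : ∀ {b} → Bool → (Fin b → Bool) → Subset b → Bool
avoids σ F [] = true
avoids σ F (x ∷ c) = (not (F zero) ∨ does (x ≟ᵇ not σ)) ∧ avoids σ (F ∘ suc) c

avoids-true⁺ : ∀ {b} σ (F : Fin b → Bool) c → (∀ a → F a ≡ true → lookup c a ≡ not σ) → avoids σ F c ≡ true
avoids-true⁺ σ F [] h = refl
avoids-true⁺ σ F (x ∷ c) h with F zero in F0
... | false = avoids-true⁺ σ (F ∘ suc) c (h ∘ suc)
... | true rewrite h zero F0 | dec-true (not σ ≟ᵇ not σ) refl = avoids-true⁺ σ (F ∘ suc) c (h ∘ suc)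

-- Each point of F halves the number of colourings that put all of F on one prescribed side.
count-avoids : ∀ b σ (F : Fin b → Bool) → count (avoids σ F) (allSubsets b) * 2 ^ count F (allFin b) ≡ 2 ^ b
count-avoids zero σ F = refl
count-avoids (suc b) σ F = begin
  count (avoids σ F) (allSubsets (suc b)) * 2 ^ count F (allFin (suc b))
    ≡⟨ cong₂ (λ u v → u * 2 ^ v) (count-allVec-suc (avoids σ F) (true ∷ false ∷ [])) (count-allFin-suc b F) ⟩
  (count (λ c → side true ∧ avoids σ (F ∘ suc) c) (allSubsets b) +
   (count (λ c → side false ∧ avoids σ (F ∘ suc) c) (allSubsets b) + 0)) * 2 ^ (𝟙 (F zero) + k)
    ≡⟨ cong (λ u → u * 2 ^ (𝟙 (F zero) + k))
         (cong₂ _+_ (count-const∧ (side true) _ (allSubsets b))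
                    (cong (_+ 0) (count-const∧ (side false) _ (allSubsets b)))) ⟩
  (𝟙 (side true) * c′ + (𝟙 (side false) * c′ + 0)) * 2 ^ (𝟙 (F zero) + k)
    ≡⟨ doubling (F zero) σ ⟩
  2 * (c′ * 2 ^ k)
    ≡⟨ cong (2 *_) (count-avoids b σ (F ∘ suc)) ⟩
  2 ^ suc b ∎
  where
  open ≡-Reasoning
  side : Bool → Bool
  side x = not (F zero) ∨ does (x ≟ᵇ not σ)
  c′ : ℕ
  c′ = count (avoids σ (F ∘ suc)) (allSubsets b)
  k : ℕ
  k = count (F ∘ suc) (allFin b)
  one-side : ∀ c p → (0 * c + (1 * c + 0)) * (2 * p) ≡ 2 * (c * p)
  one-side = solve-∀
  other-side : ∀ c p → (1 * c + (0 * c + 0)) * (2 * p) ≡ 2 * (c * p)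
  other-side = solve-∀
  both-sides : ∀ c p → (1 * c + (1 * c + 0)) * p ≡ 2 * (c * p)
  both-sides = solve-∀
  doubling : ∀ f σ →
    (𝟙 (not f ∨ does (true ≟ᵇ not σ)) * c′ + (𝟙 (not f ∨ does (false ≟ᵇ not σ)) * c′ + 0)) * 2 ^ (𝟙 f + k)
    ≡ 2 * (c′ * 2 ^ k)
  doubling true true = one-side c′ (2 ^ k)
  doubling true false = other-side c′ (2 ^ k)
  doubling false σ = both-sides c′ (2 ^ k)

<ᵇ-irrefl : ∀ n → (n <ᵇ n) ≡ false
<ᵇ-irrefl zero = refl
<ᵇ-irrefl (suc n) = <ᵇ-irrefl n

<ᵇ-suc : ∀ n → (n <ᵇ suc n) ≡ true
<ᵇ-suc zero = refl
<ᵇ-suc (suc n) = <ᵇ-suc n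

<ᵇ-step : ∀ m t → m ≢ t → (m <ᵇ suc t) ≡ (m <ᵇ t)
<ᵇ-step zero zero m≢t = ⊥-elim (m≢t refl)
<ᵇ-step zero (suc t) _ = refl
<ᵇ-step (suc m) zero _ = refl
<ᵇ-step (suc m) (suc t) m≢t = <ᵇ-step m t (m≢t ∘ cong suc)

-- A set S ⊆ B^I, kept coordinates K ⊆ I and a colouring C of the dropped coordinates I ∖ K.  A
-- σ-sided extension of w ∈ B^K up to t is a point of S agreeing with w on K whose dropped coordinates
-- j < t all lie on side σ of C j (inside for σ = true, outside for σ = false); these are the
-- witnesses the square condition needs on the X side and on the Y side respectively.
module Exposure {b s : ℕ} (S : PPt b s → Bool) (I K : Subset s) where

  _≟ₘ_ : DecidableEquality (Maybe (Fin b))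
  _≟ₘ_ = ≡-decₘ Fin._≟_

  dropped : Fin s → Bool
  dropped j = lookup I j ∧ not (lookup K j)

  onSide : Bool → Maybe (Fin b) → Subset b → Bool
  onSide σ nothing c = false
  onSide σ (just a) c = does (lookup c a ≟ᵇ σ)

  agrees : PPt b s → PPt b s → Bool
  agrees w z = all (λ j → not (lookup K j) ∨ does (lookup z j ≟ₘ lookup w j)) (allFin s)

  sidedBelow : Bool → Vec (Subset b) s → ℕ → PPt b s → Fin s → Bool
  sidedBelow σ C t z j = not ((toℕ j <ᵇ t) ∧ dropped j) ∨ onSide σ (lookup z j) (lookup C j)

  sidedExtension : Bool → PPt b s → Vec (Subset b) s → ℕ → PPt b s → Bool
  sidedExtension σ w C t z = S z ∧ (agrees w z ∧ all (sidedBelow σ C t z) (allFin s))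

  extendable : Bool → PPt b s → Vec (Subset b) s → ℕ → Bool
  extendable σ w C t = any (sidedExtension σ w C t) (allPPt b s)

  agrees⁺ : ∀ w z → (∀ i → lookup K i ≡ true → lookup z i ≡ lookup w i) → agrees w z ≡ true
  agrees⁺ w z h = all-true⁺ _ (allFin s) agree-at
    where
    agree-at : ∀ j → j ∈ₗ allFin s → not (lookup K j) ∨ does (lookup z j ≟ₘ lookup w j) ≡ true
    agree-at j _ with lookup K j in Kj
    ... | false = refl
    ... | true = dec-true (lookup z j ≟ₘ lookup w j) (h j Kj)

  agrees⁻ : ∀ w z → agrees w z ≡ true → ∀ i → lookup K i ≡ true → lookup z i ≡ lookup w i
  agrees⁻ w z ag i Ki with lookup z i ≟ₘ lookup w i | all-true⁻ _ (∈-allFin i) ag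
  ... | yes zi≡wi | _ = zi≡wi
  ... | no _ | e rewrite Ki with () ← e

  sidedExtension⁻ : ∀ σ w C t z → sidedExtension σ w C t z ≡ true →
                    S z ≡ true × agrees w z ≡ true × all (sidedBelow σ C t z) (allFin s) ≡ true
  sidedExtension⁻ σ w C t z e with ∧-true⁻ {S z} e
  ... | Sz , rest with ∧-true⁻ {agrees w z} rest
  ...   | ag , sided = Sz , ag , sided

  sidedExtension⁺ : ∀ σ w C t z → S z ≡ true → agrees w z ≡ true → all (sidedBelow σ C t z) (allFin s) ≡ true →
                    sidedExtension σ w C t z ≡ true
  sidedExtension⁺ σ w C t z Sz ag sided rewrite Sz | ag | sided = refl

  extendable-from-start : ∀ σ w C z → S z ≡ true → agrees w z ≡ true → extendable σ w C 0 ≡ true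
  extendable-from-start σ w C z Sz ag =
    any-true⁺ _ (∈-allPPt b s z) (sidedExtension⁺ σ w C 0 z Sz ag (all-true⁺ _ (allFin s) (λ _ _ → refl)))

  extendable-cong : ∀ σ w C C′ t t′ → (∀ z j → sidedBelow σ C t z j ≡ sidedBelow σ C′ t′ z j) →
                    extendable σ w C t ≡ extendable σ w C′ t′
  extendable-cong σ w C C′ t t′ h =
    any-cong (allPPt b s) (λ z → cong (λ u → S z ∧ (agrees w z ∧ u)) (all-cong (allFin s) (h z)))

  extendable-recolour : ∀ σ w C (j : Fin s) c → extendable σ w (C [ j ]≔ c) (toℕ j) ≡ extendable σ w C (toℕ j)
  extendable-recolour σ w C j c = extendable-cong σ w (C [ j ]≔ c) C (toℕ j) (toℕ j) unexposed
    where
    unexposed : ∀ z i → sidedBelow σ (C [ j ]≔ c) (toℕ j) z i ≡ sidedBelow σ C (toℕ j) z i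
    unexposed z i with toℕ i <ᵇ toℕ j in i<j
    ... | false = refl
    ... | true = cong (λ c′ → not (dropped i) ∨ onSide σ (lookup z i) c′) (lookup∘update′ i≢j C c)
      where
      i≢j : i ≢ j
      i≢j refl with () ← trans (sym i<j) (<ᵇ-irrefl (toℕ i))

  extendable-kept-step : ∀ σ w C (j : Fin s) → dropped j ≡ false →
                         extendable σ w C (suc (toℕ j)) ≡ extendable σ w C (toℕ j)
  extendable-kept-step σ w C j dj = extendable-cong σ w C C (suc (toℕ j)) (toℕ j) step
    where
    step : ∀ z i → sidedBelow σ C (suc (toℕ j)) z i ≡ sidedBelow σ C (toℕ j) z i
    step z i with i Fin.≟ j
    ... | yes refl rewrite <ᵇ-suc (toℕ j) | <ᵇ-irrefl (toℕ j) | dj = refl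
    ... | no i≢j rewrite <ᵇ-step (toℕ i) (toℕ j) (i≢j ∘ toℕ-injective) = refl

  sided-step : ∀ σ C (j : Fin s) c z a → lookup c a ≡ σ → all (sidedBelow σ C (toℕ j) z) (allFin s) ≡ true →
               all (sidedBelow σ (C [ j ]≔ c) (suc (toℕ j)) (z [ j ]≔ just a)) (allFin s) ≡ true
  sided-step σ C j c z a ca≡σ sided = all-true⁺ _ (allFin s) sided-at
    where
    sided-at : ∀ i → i ∈ₗ allFin s → sidedBelow σ (C [ j ]≔ c) (suc (toℕ j)) (z [ j ]≔ just a) i ≡ true
    sided-at i _ with i Fin.≟ j
    ... | yes refl rewrite lookup∘update j z (just a) | lookup∘update j C c =
      ∨-trueʳ _ (dec-true (lookup c a ≟ᵇ σ) ca≡σ)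
    ... | no i≢j rewrite <ᵇ-step (toℕ i) (toℕ j) (i≢j ∘ toℕ-injective)
                       | lookup∘update′ i≢j z (just a) | lookup∘update′ i≢j C c = all-true⁻ _ (∈-allFin i) sided

  agrees-update : ∀ w z (j : Fin s) m → lookup K j ≡ false → agrees w z ≡ true → agrees w (z [ j ]≔ m) ≡ true
  agrees-update w z j m j∉K ag =
    agrees⁺ w (z [ j ]≔ m) (λ i Ki → trans (lookup∘update′ (i≢j i Ki) z m) (agrees⁻ w z ag i Ki))
    where
    i≢j : ∀ i → lookup K i ≡ true → i ≢ j
    i≢j i Ki refl with () ← trans (sym Ki) j∉K

  extension-survives : ∀ σ w C (j : Fin s) c z a → dropped j ≡ true → sidedExtension σ w C (toℕ j) z ≡ true →
                       S (z [ j ]≔ just a) ≡ true → lookup c a ≡ σ →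
                       sidedExtension σ w (C [ j ]≔ c) (suc (toℕ j)) (z [ j ]≔ just a) ≡ true
  extension-survives σ w C j c z a dj ez Sza ca≡σ with sidedExtension⁻ σ w C (toℕ j) z ez
  ... | _ , ag , sided = sidedExtension⁺ σ w (C [ j ]≔ c) (suc (toℕ j)) (z [ j ]≔ just a) Sza
    (agrees-update w z j (just a) (not-true⁻ (proj₂ (∧-true⁻ {lookup I j} dj))) ag)
    (sided-step σ C j c z a ca≡σ sided)

  failsAt : Bool → PPt b s → Vec (Subset b) s → Fin s → Bool
  failsAt σ w C j = extendable σ w C (toℕ j) ∧ not (extendable σ w C (suc (toℕ j)))

  failure⇒avoids : ∀ σ w C (j : Fin s) c z → dropped j ≡ true → sidedExtension σ w C (toℕ j) z ≡ true →
                   extendable σ w (C [ j ]≔ c) (suc (toℕ j)) ≡ false →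
                   ∀ a → S (z [ j ]≔ just a) ≡ true → lookup c a ≡ not σ
  failure⇒avoids σ w C j c z dj ez blocked a Sza with lookup c a ≟ᵇ σ
  ... | yes ca≡σ with () ← trans (sym (extension-survives σ w C j c z a dj ez Sza ca≡σ))
                                 (any-false⁻ _ (∈-allPPt b s _) blocked)
  ... | no ca≢σ = other-side _ σ ca≢σ
    where
    other-side : ∀ x σ → x ≢ σ → x ≡ not σ
    other-side false false ne = ⊥-elim (ne refl)
    other-side false true _ = refl
    other-side true false _ = refl
    other-side true true ne = ⊥-elim (ne refl)

  extendable⇒witness : ∀ σ w C → extendable σ w C s ≡ true →
    ∃[ z ] (S z ≡ true × agrees w z ≡ true ×
            (∀ j → dropped j ≡ true → ∃[ a ] (lookup z j ≡ just a × lookup (lookup C j) a ≡ σ)))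
  extendable⇒witness σ w C e with any-true⁻ _ (allPPt b s) e
  ... | z , _ , ez with sidedExtension⁻ σ w C s z ez
  ...   | Sz , ag , sided = z , Sz , ag , on-side
    where
    on-side : ∀ j → dropped j ≡ true → ∃[ a ] (lookup z j ≡ just a × lookup (lookup C j) a ≡ σ)
    on-side j dj with lookup z j | all-true⁻ _ (∈-allFin j) sided
    ... | just a | sided-j rewrite Equivalence.to T-≡ (<⇒<ᵇ (toℕ<n j)) | dj =
      a , refl , dec-true-inverse sided-j
      where
      dec-true-inverse : ∀ {x} → does (x ≟ᵇ σ) ≡ true → x ≡ σ
      dec-true-inverse {x} e with x ≟ᵇ σ
      ... | yes x≡σ = x≡σ
    ... | nothing | sided-j rewrite Equivalence.to T-≡ (<⇒<ᵇ (toℕ<n j)) | dj with () ← sided-j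

  colourings : List (Vec (Subset b) s)
  colourings = allVec (allSubsets b) s

  unbalanced : Vec (Subset b) s → PPt b s → Bool
  unbalanced C w = not (extendable true w C s) ∨ not (extendable false w C s)

  module _ (N : ℕ) (thick : ∀ j → lookup I j ≡ true → ∀ z → S z ≡ true → N ≤ 2 ^ fiber S z j) where

    private
      none-≤ : ∀ (P : A → Bool) xs m → (∀ x → P x ≡ false) → N * count P xs ≤ m
      none-≤ P xs m never = ≤-trans (≤-reflexive (trans (cong (N *_) (count-none P xs never)) (*-zeroʳ N))) z≤n

    failsAt-recolour : ∀ σ w (j : Fin s) C → N * count (λ c → failsAt σ w (C [ j ]≔ c) j) (allSubsets b) ≤ 2 ^ b
    failsAt-recolour σ w j C with dropped j in dj
    ... | false = none-≤ _ (allSubsets b) (2 ^ b) never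
      where
      never : ∀ c → failsAt σ w (C [ j ]≔ c) j ≡ false
      never c rewrite extendable-kept-step σ w (C [ j ]≔ c) j dj =
        ∧-inverseʳ (extendable σ w (C [ j ]≔ c) (toℕ j))
    ... | true with extendable σ w C (toℕ j) in ext
    ...   | false = none-≤ _ (allSubsets b) (2 ^ b) never
      where
      never : ∀ c → failsAt σ w (C [ j ]≔ c) j ≡ false
      never c rewrite extendable-recolour σ w C j c | ext = refl
    ...   | true with any-true⁻ _ (allPPt b s) ext
    ...     | z , _ , ez = begin
      N * count (λ c → failsAt σ w (C [ j ]≔ c) j) (allSubsets b)
        ≤⟨ *-mono-≤ (thick j (proj₁ (∧-true⁻ dj)) z (proj₁ (sidedExtension⁻ σ w C (toℕ j) z ez)))
                    (count-mono _ _ (allSubsets b) fails⇒avoids) ⟩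
      2 ^ fiber S z j * count (avoids σ F) (allSubsets b)        ≡⟨ *-comm (2 ^ fiber S z j) _ ⟩
      count (avoids σ F) (allSubsets b) * 2 ^ count F (allFin b) ≡⟨ count-avoids b σ F ⟩
      2 ^ b                                                      ∎
      where
      open ≤-Reasoning
      F : Fin b → Bool
      F a = S (z [ j ]≔ just a)
      fails⇒avoids : ∀ c → failsAt σ w (C [ j ]≔ c) j ≡ true → avoids σ F c ≡ true
      fails⇒avoids c e = avoids-true⁺ σ F c (failure⇒avoids σ w C j c z dj ez
        (not-true⁻ (proj₂ (∧-true⁻ {extendable σ w (C [ j ]≔ c) (toℕ j)} e))))

    failsAt-count : ∀ σ w (j : Fin s) → N * count (λ C → failsAt σ w C j) colourings ≤ length colourings
    failsAt-count σ w j = *-cancelˡ-≤ (2 ^ b) {{m^n≢0 2 b}} (begin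
      2 ^ b * (N * fails)
        ≡⟨ x∙yz≈y∙xz (2 ^ b) N fails ⟩
      N * (2 ^ b * fails)
        ≡⟨ cong (λ m → N * (m * fails)) (sym (length-allVec (true ∷ false ∷ []) b)) ⟩
      N * (length (allSubsets b) * fails)
        ≡⟨ cong (N *_) (sym (sumBy-count-update (allSubsets b) s j (λ C → failsAt σ w C j))) ⟩
      N * sumBy (λ C → count (λ c → failsAt σ w (C [ j ]≔ c) j) (allSubsets b)) colourings
        ≡⟨ sym (sumBy-*ˡ N _ colourings) ⟩
      sumBy (λ C → N * count (λ c → failsAt σ w (C [ j ]≔ c) j) (allSubsets b)) colourings
        ≤⟨ sumBy-mono colourings (failsAt-recolour σ w j) ⟩
      sumBy (λ _ → 2 ^ b) colourings
        ≡⟨ sumBy-const (2 ^ b) colourings ⟩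
      2 ^ b * length colourings ∎)
      where
      open ≤-Reasoning
      fails : ℕ
      fails = count (λ C → failsAt σ w C j) colourings

    unextendable-count : ∀ σ w z → S z ≡ true → agrees w z ≡ true →
                         N * count (λ C → not (extendable σ w C s)) colourings ≤ s * length colourings
    unextendable-count σ w z Sz ag = begin
      N * count (λ C → not (extendable σ w C s)) colourings
        ≡⟨ cong (N *_) (count≡sumBy _ colourings) ⟩
      N * sumBy (λ C → 𝟙 (not (extendable σ w C s))) colourings
        ≤⟨ *-monoʳ-≤ N (sumBy-mono colourings
             (λ C → telescope (extendable σ w C) (extendable-from-start σ w C z Sz ag) s)) ⟩
      N * sumBy (λ C → sumBy (λ t → failure C t) (downFrom s)) colourings
        ≡⟨ cong (N *_) (sumBy-comm (λ C t → failure C t) colourings (downFrom s)) ⟩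
      N * sumBy (λ t → sumBy (λ C → failure C t) colourings) (downFrom s)
        ≡⟨ sym (sumBy-*ˡ N _ (downFrom s)) ⟩
      sumBy (λ t → N * sumBy (λ C → failure C t) colourings) (downFrom s)
        ≤⟨ sumBy-mono-downFrom s failures-at ⟩
      sumBy (λ _ → length colourings) (downFrom s)
        ≡⟨ sumBy-const _ (downFrom s) ⟩
      length colourings * length (downFrom s)
        ≡⟨ cong (length colourings *_) (length-downFrom s) ⟩
      length colourings * s
        ≡⟨ *-comm (length colourings) s ⟩
      s * length colourings ∎
      where
      open ≤-Reasoning
      failure : Vec (Subset b) s → ℕ → ℕ
      failure C t = 𝟙 (extendable σ w C t ∧ not (extendable σ w C (suc t)))
      failures-at : ∀ t → t < s → N * sumBy (λ C → failure C t) colourings ≤ length colourings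
      failures-at t t<s =
        subst (λ u → N * sumBy (λ C → failure C u) colourings ≤ length colourings) (toℕ-fromℕ< t<s)
          (subst (λ u → N * u ≤ length colourings) (count≡sumBy _ colourings)
                 (failsAt-count σ w (fromℕ< t<s)))

    unbalanced-count : ∀ (P : PPt b s → Bool) → (∀ w → P w ≡ true → ∃[ z ] (S z ≡ true × agrees w z ≡ true)) →
                       ∀ w → N * sumBy (λ C → 𝟙 (P w ∧ unbalanced C w)) colourings
                             ≤ 𝟙 (P w) * (2 * s * length colourings)
    unbalanced-count P extends w with P w in Pw
    ... | false = ≤-reflexive (trans (cong (N *_) (sumBy-const 0 colourings)) (*-zeroʳ N))
    ... | true with extends w Pw
    ...   | z , Sz , ag = begin
      N * sumBy (λ C → 𝟙 (unbalanced C w)) colourings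
        ≡⟨ cong (N *_) (sym (count≡sumBy _ colourings)) ⟩
      N * count (λ C → unbalanced C w) colourings
        ≤⟨ *-monoʳ-≤ N (count-∨ _ _ colourings) ⟩
      N * (count (λ C → not (extendable true w C s)) colourings +
           count (λ C → not (extendable false w C s)) colourings)
        ≡⟨ *-distribˡ-+ N _ _ ⟩
      N * count (λ C → not (extendable true w C s)) colourings +
      N * count (λ C → not (extendable false w C s)) colourings
        ≤⟨ +-mono-≤ (unextendable-count true w z Sz ag) (unextendable-count false w z Sz ag) ⟩
      s * length colourings + s * length colourings
        ≡⟨ both-sides s (length colourings) ⟩
      1 * (2 * s * length colourings) ∎
      where
      open ≤-Reasoning
      both-sides : ∀ x y → x * y + x * y ≡ 1 * (2 * x * y)
      both-sides = solve-∀

    ∃-mostly-balanced-colouring :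
      ∀ (P : PPt b s → Bool) → (∀ w → P w ≡ true → ∃[ z ] (S z ≡ true × agrees w z ≡ true)) →
      ∃[ C ] N * count (λ w → P w ∧ unbalanced C w) (allPPt b s) ≤ 2 * s * card P
    ∃-mostly-balanced-colouring P extends =
      sumBy≤*length⇒∃≤ (λ C → N * count (λ w → P w ∧ unbalanced C w) W) (2 * s * card P) colourings
        colourings-nonempty total
      where
      open ≤-Reasoning
      W : List (PPt b s)
      W = allPPt b s
      colourings-nonempty : 0 < length colourings
      colourings-nonempty =
        subst (0 <_) (sym (trans (length-allVec (allSubsets b) s) (cong (_^ s) (length-allVec _ b))))
              (m^n>0 (2 ^ b) {{m^n≢0 2 b}} s)
      total : sumBy (λ C → N * count (λ w → P w ∧ unbalanced C w) W) colourings ≤ 2 * s * card P * length colourings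
      total = begin
        sumBy (λ C → N * count (λ w → P w ∧ unbalanced C w) W) colourings
          ≡⟨ sumBy-*ˡ N _ colourings ⟩
        N * sumBy (λ C → count (λ w → P w ∧ unbalanced C w) W) colourings
          ≡⟨ cong (N *_) (sumBy-cong colourings (λ C → count≡sumBy _ W)) ⟩
        N * sumBy (λ C → sumBy (λ w → 𝟙 (P w ∧ unbalanced C w)) W) colourings
          ≡⟨ cong (N *_) (sumBy-comm _ colourings W) ⟩
        N * sumBy (λ w → sumBy (λ C → 𝟙 (P w ∧ unbalanced C w)) colourings) W
          ≡⟨ sym (sumBy-*ˡ N _ W) ⟩
        sumBy (λ w → N * sumBy (λ C → 𝟙 (P w ∧ unbalanced C w)) colourings) W
          ≤⟨ sumBy-mono W (unbalanced-count P extends) ⟩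
        sumBy (λ w → 𝟙 (P w) * (2 * s * length colourings)) W
          ≡⟨ sumBy-cong W (λ w → *-comm (𝟙 (P w)) _) ⟩
        sumBy (λ w → 2 * s * length colourings * 𝟙 (P w)) W
          ≡⟨ sumBy-*ˡ (2 * s * length colourings) _ W ⟩
        2 * s * length colourings * sumBy (𝟙 ∘ P) W
          ≡⟨ cong (2 * s * length colourings *_) (sym (count≡sumBy P W)) ⟩
        2 * s * length colourings * card P
          ≡⟨ xy∙z≈xz∙y (2 * s) (length colourings) (card P) ⟩
        2 * s * card P * length colourings ∎

-- Arithmetic

^-distribʳ-* : ∀ a c k → (a * c) ^ k ≡ a ^ k * c ^ k
^-distribʳ-* a c zero = refl
^-distribʳ-* a c (suc k) rewrite ^-distribʳ-* a c k = shuffle a c (a ^ k) (c ^ k)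
  where
  shuffle : ∀ a c x y → a * c * (x * y) ≡ a * x * (c * y)
  shuffle = solve-∀

few-unbalanced : ∀ n s bad p → 2 ≤ n → s ≤ n → n ^ 10 * bad ≤ 2 * s * p → 20 * bad ≤ p
few-unbalanced n s bad p 2≤n s≤n h =
  *-cancelˡ-≤ (2 * n) {{m*n≢0 2 n {{_}} {{>-nonZero (≤-trans z<s 2≤n)}}}} (begin
  2 * n * (20 * bad) ≡⟨ reorder n bad ⟩
  40 * n * bad       ≤⟨ *-monoˡ-≤ bad 40n≤n^10 ⟩
  n ^ 10 * bad       ≤⟨ h ⟩
  2 * s * p          ≤⟨ *-monoˡ-≤ p (*-monoʳ-≤ 2 s≤n) ⟩
  2 * n * p          ∎)
  where
  open ≤-Reasoning
  reorder : ∀ n b → 2 * n * (20 * b) ≡ 40 * n * b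
  reorder = solve-∀
  40n≤n^10 : 40 * n ≤ n ^ 10
  40n≤n^10 = ≤-trans (*-monoˡ-≤ n (≤-trans (m≤m+n 40 472) (^-monoˡ-≤ 9 2≤n))) (≤-reflexive (*-comm (n ^ 9) n))

avgDeg-from-balance : ∀ n e e′ p q → e ≤ e′ → 25 * n * (e′ * e′) ≤ 4 * (p * p) → 19 * p ≤ 20 * q →
                      4 * n * (e * e) ≤ q * q
avgDeg-from-balance n e e′ p q e≤e′ balanced 19p≤20q = *-cancelˡ-≤ 400 (begin
  400 * (4 * n * (e * e))    ≤⟨ *-monoʳ-≤ 400 (*-monoʳ-≤ (4 * n) (*-mono-≤ e≤e′ e≤e′)) ⟩
  400 * (4 * n * (e′ * e′))  ≡⟨ scale n (e′ * e′) ⟩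
  64 * (25 * n * (e′ * e′))  ≤⟨ *-monoʳ-≤ 64 balanced ⟩
  64 * (4 * (p * p))         ≡⟨ square-256 p ⟩
  256 * (p * p)              ≤⟨ *-monoˡ-≤ (p * p) (m≤m+n 256 105) ⟩
  361 * (p * p)              ≡⟨ square-361 p ⟩
  (19 * p) * (19 * p)        ≤⟨ *-mono-≤ 19p≤20q 19p≤20q ⟩
  (20 * q) * (20 * q)        ≡⟨ square-400 q ⟩
  400 * (q * q)              ∎)
  where
  open ≤-Reasoning
  scale : ∀ n x → 400 * (4 * n * x) ≡ 64 * (25 * n * x)
  scale = solve-∀
  square-256 : ∀ p → 64 * (4 * (p * p)) ≡ 256 * (p * p)
  square-256 = solve-∀
  square-361 : ∀ p → 361 * (p * p) ≡ (19 * p) * (19 * p)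
  square-361 = solve-∀
  square-400 : ∀ q → (20 * q) * (20 * q) ≡ 400 * (q * q)
  square-400 = solve-∀

size-from-growth : ∀ k n SS p q → 4 ^ k * SS ≤ (25 * n) ^ k * (p * p) → 19 * p ≤ 20 * q →
                   81 * SS ≤ 100 * (q * q) * (9 * n) ^ k
size-from-growth k n SS p q growth 19p≤20q =
  *-cancelˡ-≤ (361 * u) {{m*n≢0 361 u {{_}} {{m^n≢0 4 k}}}} (begin
    361 * u * (81 * SS)                ≡⟨ scale₁ u SS ⟩
    29241 * (u * SS)                   ≤⟨ *-monoʳ-≤ 29241 growth ⟩
    29241 * (w * (p * p))              ≡⟨ scale₂ w p ⟩
    81 * (w * ((19 * p) * (19 * p)))   ≤⟨ *-monoʳ-≤ 81 (*-monoʳ-≤ w (*-mono-≤ 19p≤20q 19p≤20q)) ⟩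
    81 * (w * ((20 * q) * (20 * q)))   ≡⟨ scale₃ w q ⟩
    32400 * (w * (q * q))              ≤⟨ *-monoʳ-≤ 32400 (*-monoˡ-≤ (q * q) w≤uv) ⟩
    32400 * (u * v * (q * q))          ≤⟨ *-monoˡ-≤ (u * v * (q * q)) (m≤m+n 32400 3700) ⟩
    36100 * (u * v * (q * q))          ≡⟨ scale₄ u v q ⟩
    361 * u * (100 * (q * q) * v)      ∎)
  where
  open ≤-Reasoning
  u : ℕ
  u = 4 ^ k
  v : ℕ
  v = (9 * n) ^ k
  w : ℕ
  w = (25 * n) ^ k
  w≤uv : w ≤ u * v
  w≤uv = ≤-trans (^-monoˡ-≤ k (*-monoˡ-≤ n (m≤m+n 25 11)))
                 (≤-reflexive (trans (cong (_^ k) (*-assoc 4 9 n)) (^-distribʳ-* 4 (9 * n) k)))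
  scale₁ : ∀ u x → 361 * u * (81 * x) ≡ 29241 * (u * x)
  scale₁ = solve-∀
  scale₂ : ∀ w p → 29241 * (w * (p * p)) ≡ 81 * (w * ((19 * p) * (19 * p)))
  scale₂ = solve-∀
  scale₃ : ∀ w q → 81 * (w * ((20 * q) * (20 * q))) ≡ 32400 * (w * (q * q))
  scale₃ = solve-∀
  scale₄ : ∀ u v q → 36100 * (u * v * (q * q)) ≡ 361 * u * (100 * (q * q) * v)
  scale₄ = solve-∀

growth-excludes-singleton : ∀ k n SS p → 9 ^ k * n ^ k < SS → 4 ^ k * SS ≤ (25 * n) ^ k * (p * p) → p ≤ 1 → ⊥
growth-excludes-singleton k n SS p large growth p≤1 = <-irrefl refl (begin-strict
  4 ^ k * (9 ^ k * n ^ k)  <⟨ *-monoʳ-< (4 ^ k) {{m^n≢0 4 k}} large ⟩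
  4 ^ k * SS               ≤⟨ growth ⟩
  (25 * n) ^ k * (p * p)   ≤⟨ *-monoʳ-≤ ((25 * n) ^ k) (*-mono-≤ p≤1 p≤1) ⟩
  (25 * n) ^ k * 1         ≡⟨ *-identityʳ _ ⟩
  (25 * n) ^ k             ≡⟨ ^-distribʳ-* 25 n k ⟩
  25 ^ k * n ^ k           ≤⟨ *-monoˡ-≤ (n ^ k) (^-monoˡ-≤ k (m≤m+n 25 11)) ⟩
  36 ^ k * n ^ k           ≡⟨ cong (_* n ^ k) (^-distribʳ-* 4 9 k) ⟩
  4 ^ k * 9 ^ k * n ^ k    ≡⟨ *-assoc (4 ^ k) (9 ^ k) (n ^ k) ⟩
  4 ^ k * (9 ^ k * n ^ k)  ∎)
  where open ≤-Reasoning

-- Greedy projection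

∈⇒lookup : ∀ {s} {p : Subset s} {i} → i ∈ p → lookup p i ≡ true
∈⇒lookup = []=⇒lookup

lookup⇒∈ : ∀ {s} {p : Subset s} {i} → lookup p i ≡ true → i ∈ p
lookup⇒∈ {p = p} {i} = lookup⇒[]= i p

∉⇒lookup : ∀ {s} {p : Subset s} {i} → i ∉ p → lookup p i ≡ false
∉⇒lookup {p = p} {i} i∉p with lookup p i in e
... | true = ⊥-elim (i∉p (lookup⇒∈ e))
... | false = refl

lookup⇒∉ : ∀ {s} {p : Subset s} {i} → lookup p i ≡ false → i ∉ p
lookup⇒∉ e i∈p with () ← trans (sym (∈⇒lookup i∈p)) e

∣p[i]≔false∣ : ∀ {s} (p : Subset s) (i : Fin s) → lookup p i ≡ true → suc ∣ p [ i ]≔ false ∣ ≡ ∣ p ∣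
∣p[i]≔false∣ (true ∷ p) zero _ = refl
∣p[i]≔false∣ (true ∷ p) (suc i) e = cong suc (∣p[i]≔false∣ p i e)
∣p[i]≔false∣ (false ∷ p) (suc i) e = ∣p[i]≔false∣ p i e

∣p∣≡0⇒lookup≡false : ∀ {s} (p : Subset s) → ∣ p ∣ ≡ 0 → ∀ i → lookup p i ≡ false
∣p∣≡0⇒lookup≡false (false ∷ p) e zero = refl
∣p∣≡0⇒lookup≡false (false ∷ p) e (suc i) = ∣p∣≡0⇒lookup≡false p e i

cardProj-mono : ∀ {b s} (P Q : PPt b s → Bool) i → (∀ w → P w ≡ true → Q w ≡ true) → cardProj P i ≤ cardProj Q i
cardProj-mono {b} {s} P Q i P⊆Q = count-mono _ _ (allPPt b s) erased
  where
  erased : ∀ w → is-nothing (lookup w i) ∧ any (λ a → P (w [ i ]≔ just a)) (allFin b) ≡ true →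
                 is-nothing (lookup w i) ∧ any (λ a → Q (w [ i ]≔ just a)) (allFin b) ≡ true
  erased w e with ∧-true⁻ {is-nothing (lookup w i)} e
  ... | undefined , extensible with any-true⁻ _ (allFin b) extensible
  ...   | a , _ , Pwa rewrite undefined = any-true⁺ _ (∈-allFin a) (P⊆Q _ Pwa)

module Projection {b s : ℕ} (S : PPt b s → Bool) where

  -- The paper's P_{-i}; card (erase P i) unfolds to cardProj P i.
  erase : (PPt b s → Bool) → Fin s → PPt b s → Bool
  erase P i w = is-nothing (lookup w i) ∧ any (λ a → P (w [ i ]≔ just a)) (allFin b)

  ProjectionOn : Subset s → (PPt b s → Bool) → Set
  ProjectionOn K P = ∀ w → P w ≡ true →
    (∀ i → lookup K i ≡ true → ∃[ a ] lookup w i ≡ just a) ×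
    (∀ i → lookup K i ≡ false → lookup w i ≡ nothing) ×
    ∃[ z ] (S z ≡ true × (∀ i → lookup K i ≡ true → lookup z i ≡ lookup w i))

  projectionOn-erase : ∀ K P i → ProjectionOn K P → ProjectionOn (K [ i ]≔ false) (erase P i)
  projectionOn-erase K P i proj w e with ∧-true⁻ {is-nothing (lookup w i)} e
  ... | wi-undefined , extensible with any-true⁻ _ (allFin b) extensible
  ...   | a , _ , Pwa with proj (w [ i ]≔ just a) Pwa
  ...     | defined , undefined , z , Sz , z-agrees = defined′ , undefined′ , z , Sz , z-agrees′
    where
    j≢i : ∀ j → lookup (K [ i ]≔ false) j ≡ true → j ≢ i
    j≢i j e refl rewrite lookup∘update i K false with () ← e
    kept : ∀ j → lookup (K [ i ]≔ false) j ≡ true → lookup K j ≡ true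
    kept j e = trans (sym (lookup∘update′ (j≢i j e) K false)) e
    wa≡w : ∀ j → lookup (K [ i ]≔ false) j ≡ true → lookup (w [ i ]≔ just a) j ≡ lookup w j
    wa≡w j e = lookup∘update′ (j≢i j e) w (just a)
    defined′ : ∀ j → lookup (K [ i ]≔ false) j ≡ true → ∃[ a′ ] lookup w j ≡ just a′
    defined′ j e with defined j (kept j e)
    ... | a′ , wj = a′ , trans (sym (wa≡w j e)) wj
    undefined′ : ∀ j → lookup (K [ i ]≔ false) j ≡ false → lookup w j ≡ nothing
    undefined′ j e with j Fin.≟ i
    ... | yes refl = is-nothing⁻ (lookup w i) wi-undefined
    ... | no j≢i =
      trans (sym (lookup∘update′ j≢i w (just a))) (undefined j (trans (sym (lookup∘update′ j≢i K false)) e))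
    z-agrees′ : ∀ j → lookup (K [ i ]≔ false) j ≡ true → lookup z j ≡ lookup w j
    z-agrees′ j e = trans (z-agrees j (kept j e)) (wa≡w j e)

  projectionOn-self : ∀ I → SubsetOfPow I S → ProjectionOn I S
  projectionOn-self I on-I w Sw =
    (λ i Ii → proj₁ (on-I w Sw) i (lookup⇒∈ Ii)) , (λ i Ii → proj₂ (on-I w Sw) i (lookup⇒∉ Ii)) ,
    w , Sw , (λ _ _ → refl)

  module _ (n : ℕ) (I : Subset s) where

    record BalancedProjection : Set where
      field
        K : Subset s
        P : PPt b s → Bool
        steps : ℕ
        K⊆I : ∀ i → lookup K i ≡ true → lookup I i ≡ true
        projection : ProjectionOn K P
        steps+∣K∣ : steps + ∣ K ∣ ≡ ∣ I ∣
        growth : 4 ^ steps * (card S * card S) ≤ (25 * n) ^ steps * (card P * card P)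
        balanced : ∀ i → lookup K i ≡ true → 25 * n * (cardProj P i * cardProj P i) ≤ 4 * (card P * card P)

      ∣I∣∸∣K∣≡steps : ∣ I ∣ ∸ ∣ K ∣ ≡ steps
      ∣I∣∸∣K∣≡steps = trans (cong (_∸ ∣ K ∣) (sym steps+∣K∣)) (m+n∸n≡m steps ∣ K ∣)

      kept-nonempty : 9 ^ ∣ I ∣ * n ^ ∣ I ∣ < card S * card S → Nonempty K
      kept-nonempty large with nonempty? K
      ... | yes K-nonempty = K-nonempty
      ... | no K-empty =
        ⊥-elim (growth-excludes-singleton steps n _ (card P) large′ growth (card-undefined≤1 P undefined))
        where
        ∣K∣≡0 : ∣ K ∣ ≡ 0
        ∣K∣≡0 = trans (cong ∣_∣ (Empty-unique K-empty)) (∣⊥∣≡0 s)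
        large′ : 9 ^ steps * n ^ steps < card S * card S
        large′ rewrite trans (sym (+-identityʳ steps)) (trans (cong (steps +_) (sym ∣K∣≡0)) steps+∣K∣) = large
        undefined : ∀ w → P w ≡ true → ∀ i → lookup w i ≡ nothing
        undefined w Pw i = proj₁ (proj₂ (projection w Pw)) i (∉⇒lookup (λ i∈K → K-empty (i , i∈K)))

    balance : ∀ m K (P : PPt b s → Bool) steps → ∣ K ∣ ≡ m →
              (∀ i → lookup K i ≡ true → lookup I i ≡ true) → ProjectionOn K P → steps + ∣ K ∣ ≡ ∣ I ∣ →
              4 ^ steps * (card S * card S) ≤ (25 * n) ^ steps * (card P * card P) → BalancedProjection
    balance m K P steps ∣K∣≡m K⊆I proj size growth
      with any? (λ i → (lookup K i ≟ᵇ true) ×-dec (4 * (card P * card P) <? 25 * n * (cardProj P i * cardProj P i)))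
    ... | no none = record
      { K = K ; P = P ; steps = steps ; K⊆I = K⊆I ; projection = proj ; steps+∣K∣ = size ; growth = growth
      ; balanced = λ i Ki → ≮⇒≥ (λ lt → none (i , Ki , lt)) }
    ... | yes (i , Ki , unbalanced-at-i) with m
    ...   | zero with () ← trans (sym Ki) (∣p∣≡0⇒lookup≡false K ∣K∣≡m i)
    ...   | suc m′ = balance m′ (K [ i ]≔ false) (erase P i) (suc steps)
        (suc-injective (trans (∣p[i]≔false∣ K i Ki) ∣K∣≡m))
        (λ j e → K⊆I j (trans (sym (lookup∘update′ (j≢i j e) K false)) e))
        (projectionOn-erase K P i proj)
        (trans (sym (+-suc steps _)) (trans (cong (steps +_) (∣p[i]≔false∣ K i Ki)) size))
        growth′
      where
      j≢i : ∀ j → lookup (K [ i ]≔ false) j ≡ true → j ≢ i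
      j≢i j e refl rewrite lookup∘update i K false with () ← e
      SS : ℕ
      SS = card S * card S
      PP : ℕ
      PP = card P * card P
      QQ : ℕ
      QQ = cardProj P i * cardProj P i
      growth′ : 4 ^ suc steps * SS ≤ (25 * n) ^ suc steps * QQ
      growth′ = begin
        4 * 4 ^ steps * SS                ≡⟨ *-assoc 4 (4 ^ steps) SS ⟩
        4 * (4 ^ steps * SS)              ≤⟨ *-monoʳ-≤ 4 growth ⟩
        4 * ((25 * n) ^ steps * PP)       ≡⟨ x∙yz≈y∙xz 4 ((25 * n) ^ steps) PP ⟩
        (25 * n) ^ steps * (4 * PP)       ≤⟨ *-monoʳ-≤ ((25 * n) ^ steps) (<⇒≤ unbalanced-at-i) ⟩
        (25 * n) ^ steps * (25 * n * QQ)  ≡⟨ x∙yz≈y∙xz ((25 * n) ^ steps) (25 * n) QQ ⟩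
        25 * n * ((25 * n) ^ steps * QQ)  ≡⟨ sym (*-assoc (25 * n) ((25 * n) ^ steps) QQ) ⟩
        (25 * n) ^ suc steps * QQ         ∎
        where open ≤-Reasoning

-- The restricted square

module Restriction {b s : ℕ} (X Y : Pt b s → Bool) (I : Subset s) (S : PPt b s → Bool) (A : Fin s → Subset b)
                   (square : IsSquare X Y I S A) (K : Subset s) (K⊆I : ∀ i → lookup K i ≡ true → lookup I i ≡ true)
                   (P : PPt b s → Bool) (projection : Projection.ProjectionOn S K P) (C : Vec (Subset b) s) where

  open Exposure S I K

  balancedPart : PPt b s → Bool
  balancedPart w = P w ∧ not (unbalanced C w)

  A′ : Fin s → Subset b
  A′ i = if lookup I i then lookup C i else A i

  witness-restricts : ∀ (x : Pt b s) w z → Restricts I x z → agrees w z ≡ true → Restricts K x w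
  witness-restricts x w z x↾z ag i i∈K =
    trans (sym (agrees⁻ w z ag i (∈⇒lookup i∈K))) (x↾z i (lookup⇒∈ (K⊆I i (∈⇒lookup i∈K))))

  witness-outside : ∀ σ (x : Pt b s) z → Restricts I x z → (∀ i → i ∉ I → lookup (A i) (lookup x i) ≡ σ) →
                    (∀ j → dropped j ≡ true → ∃[ a ] (lookup z j ≡ just a × lookup (lookup C j) a ≡ σ)) →
                    ∀ i → i ∉ K → lookup (A′ i) (lookup x i) ≡ σ
  witness-outside σ x z x↾z outside-I on-side i i∉K with lookup I i in Ii
  ... | false = outside-I i (lookup⇒∉ Ii)
  ... | true with on-side i (trans (cong (_∧ not (lookup K i)) Ii) (cong not (∉⇒lookup i∉K)))
  ...   | a , zi≡a , Cia≡σ =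
    subst (λ a′ → lookup (lookup C i) a′ ≡ σ) (just-injective (trans (sym zi≡a) (x↾z i (lookup⇒∈ Ii)))) Cia≡σ

  restricted-square : IsSquare X Y K balancedPart A′
  restricted-square = on-K , witnesses
    where
    on-K : SubsetOfPow K balancedPart
    on-K w e with projection w (proj₁ (∧-true⁻ {P w} e))
    ... | defined , undefined , _ =
      (λ i i∈K → defined i (∈⇒lookup i∈K)) , (λ i i∉K → undefined i (∉⇒lookup i∉K))
    witnesses : ∀ w → balancedPart w ≡ true →
      (∃[ x ] (X x ≡ true × Restricts K x w × (∀ i → i ∉ K → lookup x i ∈ A′ i))) ×
      (∃[ y ] (Y y ≡ true × Restricts K y w × (∀ i → i ∉ K → lookup y i ∉ A′ i)))
    witnesses w e with nor⇒both (not-true⁻ (proj₂ (∧-true⁻ {P w} e)))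
    ... | inside , outside
      with extendable⇒witness true w C inside | extendable⇒witness false w C outside
    ... | z₁ , Sz₁ , ag₁ , on-side₁ | z₂ , Sz₂ , ag₂ , on-side₂
      with proj₁ (proj₂ square z₁ Sz₁) | proj₂ (proj₂ square z₂ Sz₂)
    ... | x , Xx , x↾z₁ , x-in-A | y , Yy , y↾z₂ , y-out-A =
      (x , Xx , witness-restricts x w z₁ x↾z₁ ag₁ ,
        (λ i i∉K → lookup⇒∈ (witness-outside true x z₁ x↾z₁ (λ i → ∈⇒lookup ∘ x-in-A i) on-side₁ i i∉K))) ,
      (y , Yy , witness-restricts y w z₂ y↾z₂ ag₂ ,
        (λ i i∉K → lookup⇒∉ (witness-outside false y z₂ y↾z₂ (λ i → ∉⇒lookup ∘ y-out-A i) on-side₂ i i∉K)))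

  balancedPart-large : ∀ n → 2 ≤ n → s ≤ n →
                       n ^ 10 * count (λ w → P w ∧ unbalanced C w) (allPPt b s) ≤ 2 * s * card P →
                       19 * card P ≤ 20 * card balancedPart
  balancedPart-large n 2≤n s≤n few = +-cancelˡ-≤ (card P) _ _ (begin
    20 * card P                        ≡⟨ cong (20 *_) (count-split P (unbalanced C) (allPPt b s)) ⟩
    20 * (bad + card balancedPart)     ≡⟨ *-distribˡ-+ 20 bad _ ⟩
    20 * bad + 20 * card balancedPart  ≤⟨ +-monoˡ-≤ _ (few-unbalanced n s bad (card P) 2≤n s≤n few) ⟩
    card P + 20 * card balancedPart    ∎)
    where
    open ≤-Reasoning
    bad : ℕ
    bad = count (λ w → P w ∧ unbalanced C w) (allPPt b s)

Refinement : ∀ {b s} (n : ℕ) (X Y : Pt b s → Bool) (I : Subset s) (S : PPt b s → Bool) → Set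
Refinement n X Y I S =
  ∃[ I' ] ∃[ S' ] ∃[ A' ]
    (IsSquare X Y I' S' A' ×
     I' ⊆ I ×
     Nonempty I' ×
     AvgDeg2Sqrt n I' S' ×
     81 * (card S * card S) ≤ 100 * (card S' * card S') * (9 * n) ^ (∣ I ∣ ∸ ∣ I' ∣))

refine : ∀ (n s b : ℕ) → 2 ≤ n → s ≤ n →
         (X Y : Pt b s → Bool) (I : Subset s) (S : PPt b s → Bool) (A : Fin s → Subset b) →
         IsSquare X Y I S A → ThickLog n I S → 9 ^ ∣ I ∣ * n ^ ∣ I ∣ < card S * card S → Refinement n X Y I S
refine n s b 2≤n s≤n X Y I S A square (_ , thick) large =
  K , balancedPart , A′ , restricted-square , lookup⇒∈ ∘ K⊆I _ ∘ ∈⇒lookup ,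
  kept-nonempty large , average-degree , size
  where
  open Projection S
  open BalancedProjection
    (balance n I ∣ I ∣ I S 0 refl (λ _ Ii → Ii) (projectionOn-self I (proj₁ square)) refl ≤-refl)
  open Exposure S I K using (agrees; agrees⁺; unbalanced; ∃-mostly-balanced-colouring)
  extends : ∀ w → P w ≡ true → ∃[ z ] (S z ≡ true × agrees w z ≡ true)
  extends w Pw with projection w Pw
  ... | _ , _ , z , Sz , z-agrees = z , Sz , agrees⁺ w z z-agrees
  colouring : ∃[ C ] n ^ 10 * count (λ w → P w ∧ unbalanced C w) (allPPt b s) ≤ 2 * s * card P
  colouring = ∃-mostly-balanced-colouring (n ^ 10) (λ j Ij → thick j (lookup⇒∈ Ij)) P extends
  open Restriction X Y I S A square K K⊆I P projection (proj₁ colouring)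
  19P≤20S′ : 19 * card P ≤ 20 * card balancedPart
  19P≤20S′ = balancedPart-large n 2≤n s≤n (proj₂ colouring)
  average-degree : AvgDeg2Sqrt n K balancedPart
  average-degree i i∈K = avgDeg-from-balance n (cardProj balancedPart i) (cardProj P i) (card P) (card balancedPart)
    (cardProj-mono balancedPart P i (λ w → proj₁ ∘ ∧-true⁻)) (balanced i (∈⇒lookup i∈K)) 19P≤20S′
  size : 81 * (card S * card S) ≤ 100 * (card balancedPart * card balancedPart) * (9 * n) ^ (∣ I ∣ ∸ ∣ K ∣)
  size = subst (λ k → 81 * (card S * card S) ≤ 100 * (card balancedPart * card balancedPart) * (9 * n) ^ k)
         (sym ∣I∣∸∣K∣≡steps) (size-from-growth steps n _ (card P) (card balancedPart) growth 19P≤20S′)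

lemma5p10 : ∀ (p q : ℕ) → 1 ≤ p → 1 ≤ q →
  ∃[ N ] (∀ (n s b : ℕ) → N ≤ n →
    s ^ (2 * q) * n ^ (2 * p) ≤ n ^ q →
    b * s ≡ n →
    (X Y : Pt b s → Bool) →
    (I : Subset s) (S : PPt b s → Bool) (A : Fin s → Subset b) →
    IsSquare X Y I S A →
    ThickLog n I S →
    9 ^ ∣ I ∣ * n ^ ∣ I ∣ < card S * card S →
    ∃[ I' ] ∃[ S' ] ∃[ A' ]
      (IsSquare X Y I' S' A' ×
       I' ⊆ I ×
       Nonempty I' ×
       AvgDeg2Sqrt n I' S' ×
       81 * (card S * card S) ≤ 100 * (card S' * card S') * (9 * n) ^ (∣ I ∣ ∸ ∣ I' ∣)))
lemma5p10 p q _ _ = 2 , λ n s b 2≤n _ bs → refine n s b 2≤n (s≤n b bs 2≤n)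
  where
  s≤n : ∀ {n s} b → b * s ≡ n → 2 ≤ n → s ≤ n
  s≤n zero refl ()
  s≤n {s = s} (suc b) refl _ = m≤n*m s (suc b)
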